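{- Let $n\ge1$ and let $R$ be a rook placement on $2\delta_n$. Construct a rooted graph $\Phi_n(R)$ on the vertex set $\{1,\ldots,n+1\}$ as follows. The root is $1$. For each $i\in\{1,\ldots,n\}$: if the left column of the $i$-th block of $R$ has a rook in row $j$, then vertex $i$ gets the left child $j+1$; if the right column of the $i$-th block has a rook in row $j$, then vertex $i$ gets the right child $j+1$; if a column has no rook, the corresponding child is absent. Then $\Phi_n(R)$ is an increasing binary tree on $n+1$ vertices.
   Context: The double staircase $2\delta_n$ is the Young diagram, in French notation, of $(2n,2(n-1),\ldots,2)$. Its rows are numbered $1,\ldots,n$ from top to bottom, so that row $j$ has $2j$ cells. Its $i$-th block (counting from the left) consists of columns $2i-1$ (the left column) and $2i$ (the right column), and occupies rows $i,\ldots,n$. A rook placement on $2\delta_n$ consists of $n$ rooks with exactly one rook per row and at most one rook per column. An increasing binary tree on $m$ vertices is a rooted tree with distinct labels from $\{1,\ldots,m\}$ in which every vertex has at most one left child and at most one right child, and every child has a larger label than its parent. -}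

module Defs where

open import Data.Nat using (ℕ; zero; suc; _+_; _*_; _<_)
open import Data.Fin using (Fin; toℕ) renaming (zero to fzero; suc to fsuc)
open import Data.Product using (Σ; _×_; _,_; ∃)
open import Relation.Binary.PropositionalEquality using (_≡_; _≢_)
open import Relation.Binary.Construct.Closure.ReflexiveTransitive using (Star)
open import Relation.Nullary using (¬_)
open import Function.Definitions using (Injective)

-- Rows of 2δ_n: row r : Fin n is row number j = toℕ r + 1, which has 2j cells.
-- Columns are 0-indexed: column index c ∈ {0,…,2j-1} is the paper's column c+1.
-- A rook placement: exactly one rook per row (a function row ↦ column),
-- lying inside the diagram, at most one rook per column (injectivity).
record RookPlacement (n : ℕ) : Set where
  field
    col     : Fin n → ℕ
    col-in  : ∀ r → col r < 2 * suc (toℕ r)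
    col-inj : Injective _≡_ _≡_ col
open RookPlacement public

data Side : Set where
  left right : Side

sideOffset : Side → ℕ
sideOffset left  = 0
sideOffset right = 1

-- A rooted binary graph on vertex set Fin m (vertex v = label toℕ v + 1)
-- is given by a root and a relation  Ch s p c : "c is the s-child of p".
Edge : ∀ {m} → (Side → Fin m → Fin m → Set) → Fin m → Fin m → Set
Edge Ch p c = Σ Side λ s → Ch s p c

record IsIncreasingBinaryTree (m : ℕ) (root : Fin m)
       (Ch : Side → Fin m → Fin m → Set) : Set where
  field
    child-unique : ∀ s p c c' → Ch s p c → Ch s p c' → c ≡ c'
    increasing   : ∀ s p c → Ch s p c → toℕ p < toℕ c
    root-orphan  : ∀ s p → ¬ Ch s p root
    unique-parent : ∀ v → v ≢ root →
      Σ (Side × Fin m) λ { (s , p) → Ch s p v ×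
        (∀ s' p' → Ch s' p' v → (s' , p') ≡ (s , p)) }
    connected    : ∀ v → Star (Edge Ch) root v

-- Vertex i (label toℕ p + 1 ∈ {1..n}) has s-child j+1 iff the s-column of block i,
-- i.e. 0-indexed column 2·toℕ p + sideOffset s, holds a rook in row j.
-- With row r : Fin n being row j = toℕ r + 1, the child is label j+1 = vertex fsuc r.
PhiChild : ∀ {n} → RookPlacement n → Side → Fin (suc n) → Fin (suc n) → Set
PhiChild {n} R s p c =
  toℕ p < n × Σ (Fin n) λ r → col R r ≡ 2 * toℕ p + sideOffset s × c ≡ fsuc r

Phi-root : ∀ {n} → Fin (suc n)
Phi-root = fzero

-- Column c of the diagram is the s-column of block q exactly when c = 2q + [s = right],
-- and a rook in row j can only sit in a block q ≤ j. Hence every row j determines a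
-- unique parent q + 1 < j + 1 of vertex j + 1, while injectivity of the rook columns
-- gives at most one child per side. Following parents strictly decreases the label,
-- so every vertex is reached from the root 1.
module Submission where

open import Defs
open import Data.Nat using (ℕ; zero; suc; _≥_; _+_; _*_; _<_; s≤s)
open import Data.Nat.Properties
  using (*-suc; *-cancelˡ-<; ≤-<-trans; m≤m+n; ≤-trans; ≤-refl; m<n⇒m<1+n)
open import Data.Fin using (Fin; toℕ; fromℕ<) renaming (zero to fzero; suc to fsuc)
open import Data.Fin.Properties using (toℕ-fromℕ<; toℕ-injective; toℕ<n)
open import Data.Product using (Σ; _×_; _,_; proj₁; proj₂; map₂)
open import Data.Product.Properties using (,-injectiveˡ; ,-injectiveʳ)
open import Function using (_∘_)
open import Relation.Binary.PropositionalEquality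
open import Relation.Binary.Construct.Closure.ReflexiveTransitive using (Star; ε; _◅_; _◅◅_)
open import Relation.Nullary using (¬_)
open import Data.Empty using (⊥-elim)

column : Side → ℕ → ℕ
column s q = 2 * q + sideOffset s

column-suc : ∀ s q → column s (suc q) ≡ suc (suc (column s q))
column-suc s q = cong (_+ sideOffset s) (*-suc 2 q)

blockOf : ℕ → Side × ℕ
blockOf zero          = left , 0
blockOf (suc zero)    = right , 0
blockOf (suc (suc c)) = map₂ suc (blockOf c)

column-blockOf : ∀ c → let (s , q) = blockOf c in column s q ≡ c
column-blockOf zero          = refl
column-blockOf (suc zero)    = refl
column-blockOf (suc (suc c)) = let (s , q) = blockOf c in
  trans (column-suc s q) (cong (suc ∘ suc) (column-blockOf c))

blockOf-column : ∀ s q → blockOf (column s q) ≡ (s , q)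
blockOf-column left  zero    = refl
blockOf-column right zero    = refl
blockOf-column s     (suc q) rewrite column-suc s q | blockOf-column s q = refl

column-injective : ∀ {s s′ q q′} → column s q ≡ column s′ q′ → s ≡ s′ × q ≡ q′
column-injective {s} {s′} {q} {q′} e = ,-injectiveˡ sq≡ , ,-injectiveʳ sq≡
  where
    sq≡ : (s , q) ≡ (s′ , q′)
    sq≡ = trans (sym (blockOf-column s q)) (trans (cong blockOf e) (blockOf-column s′ q′))

column<⇒block< : ∀ s q j → column s q < 2 * j → q < j
column<⇒block< s q j h = *-cancelˡ-< 2 q j (≤-<-trans (m≤m+n (2 * q) (sideOffset s)) h)

module _ {n : ℕ} (R : RookPlacement n) where

  private
    Ch : Side → Fin (suc n) → Fin (suc n) → Set
    Ch = PhiChild R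

  block<row : ∀ s q r → col R r ≡ column s q → q < suc (toℕ r)
  block<row s q r e = column<⇒block< s q (suc (toℕ r)) (subst (_< _) e (col-in R r))

  increasing : ∀ s p c → Ch s p c → toℕ p < toℕ c
  increasing s p _ (_ , r , e , refl) = block<row s (toℕ p) r e

  child-unique : ∀ s p c c′ → Ch s p c → Ch s p c′ → c ≡ c′
  child-unique s p _ _ (_ , r , e , refl) (_ , r′ , e′ , refl) =
    cong fsuc (col-inj R (trans e (sym e′)))

  root-orphan : ∀ s p → ¬ Ch s p fzero
  root-orphan s p (_ , _ , _ , ())

  parent-unique : ∀ {s s′ p p′ c} → Ch s p c → Ch s′ p′ c → (s′ , p′) ≡ (s , p)
  parent-unique {s} {s′} (_ , r , e , refl) (_ , .r , e′ , refl)
    with refl , q≡ ← column-injective {s′} {s} (trans (sym e′) e) = cong (s ,_) (toℕ-injective q≡)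

  parent : (r : Fin n) → Σ (Side × Fin (suc n)) λ (s , p) → Ch s p (fsuc r)
  parent r = (s , p) , subst (_< n) (sym toℕp≡q) q<n , r , col≡column , refl
    where
      s : Side
      s = proj₁ (blockOf (col R r))
      q : ℕ
      q = proj₂ (blockOf (col R r))
      q<n : q < n
      q<n = ≤-trans (block<row s q r (sym (column-blockOf (col R r)))) (toℕ<n r)
      p : Fin (suc n)
      p = fromℕ< (m<n⇒m<1+n q<n)
      toℕp≡q : toℕ p ≡ q
      toℕp≡q = toℕ-fromℕ< (m<n⇒m<1+n q<n)
      col≡column : col R r ≡ column s (toℕ p)
      col≡column = trans (sym (column-blockOf (col R r))) (cong (column s) (sym toℕp≡q))

  reachable-below : ∀ k v → toℕ v < k → Star (Edge Ch) fzero v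
  reachable-below _       fzero    _       = ε
  reachable-below (suc k) (fsuc r) (s≤s v<k) =
    let (s , p) , p→v = parent r in
    reachable-below k p (≤-trans (increasing s p (fsuc r) p→v) v<k) ◅◅ ((s , p→v) ◅ ε)

  Phi-isIncreasingBinaryTree : IsIncreasingBinaryTree (suc n) Phi-root Ch
  Phi-isIncreasingBinaryTree = record
    { child-unique  = child-unique
    ; increasing    = increasing
    ; root-orphan   = root-orphan
    ; unique-parent = λ { fzero root≢root → ⊥-elim (root≢root refl)
                        ; (fsuc r) _ → let sp , p→v = parent r in
                            sp , p→v , λ _ _ p′→v → parent-unique p→v p′→v }
    ; connected     = λ v → reachable-below (suc (toℕ v)) v ≤-refl
    }

lemma3p1 : (n : ℕ) → n ≥ 1 → (R : RookPlacement n) →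
    IsIncreasingBinaryTree (suc n) Phi-root (PhiChild R)
lemma3p1 _ _ = Phi-isIncreasingBinaryTree
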